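{- Let $q$ be a prime power and let $C$ be a cover of $PG(3,q)$ consisting of $r$ points and $s$ planes. If $r+s\le q^2+q$, then $r\ge q$ and $s\ge q$.
   Context: $PG(v-1,q)$ is the projective space whose points, lines and planes are the $1$-, $2$- and $3$-dimensional subspaces of $GF(q)^v$; incidence is containment. A cover of $PG(v-1,q)$ is a set of points and planes such that every line is incident with at least one of these points or planes. -}

module Defs where

open import Level using (Level; _⊔_; suc)
open import Data.Nat using (ℕ)
open import Data.Fin using (Fin)
open import Data.Product using (Σ; ∃; _×_)
open import Data.Sum using (_⊎_)
open import Relation.Nullary using (¬_)
open import Algebra.Bundles using (CommutativeRing)
import Data.Vec.Functional as VF
open import Relation.Binary.PropositionalEquality using (_≡_)

record IsFieldRing {c ℓ : Level} (R : CommutativeRing c ℓ) : Set (c ⊔ ℓ) where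
  open CommutativeRing R
  field
    0#≉1# : ¬ (0# ≈ 1#)
    inverse : ∀ x → ¬ (x ≈ 0#) → Σ Carrier (λ y → (x * y) ≈ 1#)

record HasOrder {c ℓ : Level} (R : CommutativeRing c ℓ) (q : ℕ) : Set (c ⊔ ℓ) where
  open CommutativeRing R
  field
    enum : Fin q → Carrier
    enum-injective : ∀ i j → enum i ≈ enum j → i ≡ j
    enum-surjective : ∀ x → Σ (Fin q) (λ i → enum i ≈ x)

module Linear {c ℓ : Level} (R : CommutativeRing c ℓ) where
  open CommutativeRing R

  Vect : ℕ → Set c
  Vect v = Fin v → Carrier

  _≈ᵥ_ : ∀ {v} → Vect v → Vect v → Set ℓ
  x ≈ᵥ y = ∀ i → x i ≈ y i

  zeroᵥ : ∀ {v} → Vect v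
  zeroᵥ _ = 0#

  _+ᵥ_ : ∀ {v} → Vect v → Vect v → Vect v
  (x +ᵥ y) i = x i + y i

  _·ᵥ_ : ∀ {v} → Carrier → Vect v → Vect v
  (a ·ᵥ x) i = a * x i

  lincomb : ∀ {v k} → (Fin k → Carrier) → (Fin k → Vect v) → Vect v
  lincomb {k = k} cs bs = VF.foldr _+ᵥ_ zeroᵥ (λ i → cs i ·ᵥ bs i)

  _∈Span_ : ∀ {v k} → Vect v → (Fin k → Vect v) → Set (c ⊔ ℓ)
  x ∈Span bs = Σ _ (λ cs → x ≈ᵥ lincomb cs bs)

  Independent : ∀ {v k} → (Fin k → Vect v) → Set (c ⊔ ℓ)
  Independent bs = ∀ cs → lincomb cs bs ≈ᵥ zeroᵥ → ∀ i → cs i ≈ 0#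

  record Subspace (v k : ℕ) : Set (c ⊔ ℓ) where
    constructor subspace
    field
      basis : Fin k → Vect v
      independent : Independent basis

  open Subspace public

  _⊆ₛ_ : ∀ {v k m} → Subspace v k → Subspace v m → Set (c ⊔ ℓ)
  U ⊆ₛ W = ∀ i → basis U i ∈Span basis W

  _≡ₛ_ : ∀ {v k m} → Subspace v k → Subspace v m → Set (c ⊔ ℓ)
  U ≡ₛ W = (U ⊆ₛ W) × (W ⊆ₛ U)

  -- PG(v-1,q): points, lines, planes are the 1-, 2-, 3-dim subspaces of F^v
  Point Line Plane : ℕ → Set (c ⊔ ℓ)
  Point v = Subspace v 1
  Line  v = Subspace v 2
  Plane v = Subspace v 3

  record Cover (v r s : ℕ) : Set (c ⊔ ℓ) where
    field
      points : Fin r → Point v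
      planes : Fin s → Plane v
      points-distinct : ∀ i j → points i ≡ₛ points j → i ≡ j
      planes-distinct : ∀ i j → planes i ≡ₛ planes j → i ≡ j
      covers : ∀ (L : Line v) →
               (Σ (Fin r) (λ i → points i ⊆ₛ L)) ⊎ (Σ (Fin s) (λ j → L ⊆ₛ planes j))

{-# OPTIONS --safe #-}
module Submission where

-- Planes of PG(3,q) are handled through their normal vectors, so one set PG 3 parametrises both
-- the points and the planes.  If r < q, count incidences: each cover point lies on q²+q+1 planes
-- and each cover plane is a single plane, and r(q²+q+1) + s < q³+q²+q+1.  So some plane H contains
-- no cover point and is not a cover plane.  Every one of the q²+q+1 lines of H must then lie in a
-- cover plane, and these cover planes are distinct because a plane other than H meets H in a single
-- line; hence s > q²+q ≥ r+s.  Dually, if s < q there is a point on no cover plane that is not a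
-- cover point, and the q²+q+1 lines through it need distinct cover points.

open import Defs
open import Level using (Level; _⊔_)

module FiniteSum where

  open import Data.Nat using (ℕ; zero; suc; _+_; _*_; _≤_; _<_; z≤n; s≤s; _≤?_)
  open import Data.Nat.Properties
  open import Data.Fin using (Fin; zero; suc)
  import Data.Fin.Properties as Finₚ
  open import Data.Product using (∃; _×_; _,_; proj₁; proj₂)
  open import Data.Sum using (_⊎_; inj₁; inj₂)
  open import Data.Unit using (⊤; tt)
  open import Data.Empty using (⊥; ⊥-elim)
  open import Function using (_∘_)
  open import Function.Definitions using (Injective)
  open import Relation.Nullary using (¬_; Dec; yes; no)
  open import Relation.Binary.PropositionalEquality using (_≡_; refl; sym; trans; cong; cong₂)
  open import Data.Sum.Properties using (inj₁-injective; inj₂-injective)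
  open import Algebra.Properties.CommutativeMonoid.Sum +-0-commutativeMonoid
    using (sum) renaming (∑-distrib-+ to sum-distrib-+)
  open import Algebra.Properties.CommutativeSemigroup +-commutativeSemigroup using (interchange)

  𝟙 : ∀ {p} {P : Set p} → Dec P → ℕ
  𝟙 (yes _) = 1
  𝟙 (no _)  = 0

  module _ {p} {P : Set p} where

    𝟙≤1 : (P? : Dec P) → 𝟙 P? ≤ 1
    𝟙≤1 (yes _) = s≤s z≤n
    𝟙≤1 (no _)  = z≤n

    𝟙-yes : (P? : Dec P) → P → 𝟙 P? ≡ 1
    𝟙-yes (yes _) _ = refl
    𝟙-yes (no ¬p) p = ⊥-elim (¬p p)

    𝟙-no : (P? : Dec P) → ¬ P → 𝟙 P? ≡ 0
    𝟙-no (yes p) ¬p = ⊥-elim (¬p p)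
    𝟙-no (no _)  _  = refl

    𝟙-positive⇒ : (P? : Dec P) → 1 ≤ 𝟙 P? → P
    𝟙-positive⇒ (yes p) _ = p

    𝟙-zero⇒¬ : (P? : Dec P) → 𝟙 P? ≡ 0 → ¬ P
    𝟙-zero⇒¬ (no ¬p) _ = ¬p

    𝟙-cong : ∀ {q} {Q : Set q} (P? : Dec P) (Q? : Dec Q) → (P → Q) → (Q → P) → 𝟙 P? ≡ 𝟙 Q?
    𝟙-cong (yes _) (yes _) _   _   = refl
    𝟙-cong (yes p) (no ¬q) p⇒q _   = ⊥-elim (¬q (p⇒q p))
    𝟙-cong (no ¬p) (yes q) _   q⇒p = ⊥-elim (¬p (q⇒p q))
    𝟙-cong (no _)  (no _)  _   _   = refl

  +-≤1 : ∀ {m n} → m ≤ 1 → n ≤ 1 → (1 ≤ m → 1 ≤ n → ⊥) → m + n ≤ 1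
  +-≤1 {zero}          _   n≤1 _    = n≤1
  +-≤1 {suc _} {zero}  m≤1 _   _    = ≤-trans (≤-reflexive (+-identityʳ _)) m≤1
  +-≤1 {suc _} {suc _} _   _   both = ⊥-elim (both (s≤s z≤n) (s≤s z≤n))

  +-<⇒⊎ : ∀ {a b c d} → a + b < c + d → a < c ⊎ b < d
  +-<⇒⊎ {a} {b} {c} {d} lt with c ≤? a | d ≤? b
  ... | yes c≤a | yes d≤b = ⊥-elim (<⇒≱ lt (+-mono-≤ c≤a d≤b))
  ... | no c≰a  | _       = inj₁ (≰⇒> c≰a)
  ... | yes _   | no d≰b  = inj₂ (≰⇒> d≰b)

  record Finite (A : Set) : Set where
    field
      ∑           : (A → ℕ) → ℕ
      ∑-mono-≤    : ∀ {f g} → (∀ a → f a ≤ g a) → ∑ f ≤ ∑ g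
      ∑-distrib-+ : ∀ f g → ∑ (λ a → f a + g a) ≡ ∑ f + ∑ g
      ∑-zero      : ∑ (λ _ → 0) ≡ 0
      ∑-<⇒∃<      : ∀ {f g} → ∑ f < ∑ g → ∃ λ a → f a < g a
      ∑-≤1        : ∀ {f} → (∀ a → f a ≤ 1) → (∀ a b → 1 ≤ f a → 1 ≤ f b → a ≡ b) → ∑ f ≤ 1

    size : ℕ
    size = ∑ (λ _ → 1)

    ∑-cong : ∀ {f g} → (∀ a → f a ≡ g a) → ∑ f ≡ ∑ g
    ∑-cong f≡g = ≤-antisym (∑-mono-≤ (≤-reflexive ∘ f≡g)) (∑-mono-≤ (≤-reflexive ∘ sym ∘ f≡g))

    ∑-*ˡ : ∀ k f → ∑ (λ a → k * f a) ≡ k * ∑ f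
    ∑-*ˡ zero    f = ∑-zero
    ∑-*ˡ (suc k) f = trans (∑-distrib-+ f (λ a → k * f a)) (cong (∑ f +_) (∑-*ˡ k f))

    ∑-const : ∀ k → ∑ (λ _ → k) ≡ size * k
    ∑-const k = trans (∑-cong (λ _ → sym (*-identityʳ k))) (trans (∑-*ˡ k (λ _ → 1)) (*-comm k size))

    ∑-≤-const : ∀ {f} k → (∀ a → f a ≤ k) → ∑ f ≤ size * k
    ∑-≤-const k f≤k = ≤-trans (∑-mono-≤ f≤k) (≤-reflexive (∑-const k))

    ∑<size⇒∃≡0 : ∀ {f} → ∑ f < size → ∃ λ a → f a ≡ 0
    ∑<size⇒∃≡0 lt with ∑-<⇒∃< lt
    ... | a , fa<1 = a , n<1⇒n≡0 fa<1

    ∑-positive⇒∃ : ∀ {f} → 1 ≤ ∑ f → ∃ λ a → 1 ≤ f a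
    ∑-positive⇒∃ 1≤∑f = ∑-<⇒∃< (≤-trans (s≤s (≤-reflexive ∑-zero)) 1≤∑f)

    ∑-𝟙-≤1 : ∀ {p} {P : A → Set p} (P? : ∀ a → Dec (P a)) → (∀ a b → P a → P b → a ≡ b) →
             ∑ (λ a → 𝟙 (P? a)) ≤ 1
    ∑-𝟙-≤1 P? unique =
      ∑-≤1 (𝟙≤1 ∘ P?) (λ a b 1≤a 1≤b → unique a b (𝟙-positive⇒ (P? a) 1≤a) (𝟙-positive⇒ (P? b) 1≤b))

  open Finite public

  sum-mono-≤ : ∀ n {f g : Fin n → ℕ} → (∀ i → f i ≤ g i) → sum f ≤ sum g
  sum-mono-≤ zero    _   = z≤n
  sum-mono-≤ (suc n) f≤g = +-mono-≤ (f≤g zero) (sum-mono-≤ n (f≤g ∘ suc))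

  sum-<⇒∃< : ∀ n {f g : Fin n → ℕ} → sum f < sum g → ∃ λ i → f i < g i
  sum-<⇒∃< (suc n) lt with +-<⇒⊎ lt
  ... | inj₁ f₀<g₀ = zero , f₀<g₀
  ... | inj₂ rest  with sum-<⇒∃< n rest
  ...   | i , fi<gi = suc i , fi<gi

  sum-zero : ∀ n → sum {n} (λ _ → 0) ≡ 0
  sum-zero zero    = refl
  sum-zero (suc n) = sum-zero n

  sum-≤1 : ∀ n {f : Fin n → ℕ} → (∀ i → f i ≤ 1) → (∀ i j → 1 ≤ f i → 1 ≤ f j → i ≡ j) → sum f ≤ 1
  sum-≤1 zero    _   _      = z≤n
  sum-≤1 (suc n) {f} f≤1 unique =
    +-≤1 (f≤1 zero) (sum-≤1 n (f≤1 ∘ suc) (λ i j p q → Finₚ.suc-injective (unique _ _ p q))) disjoint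
    where
    disjoint : 1 ≤ f zero → 1 ≤ sum (f ∘ suc) → ⊥
    disjoint 1≤f₀ 1≤rest with sum-<⇒∃< n (≤-trans (s≤s (≤-reflexive (sum-zero n))) 1≤rest)
    ... | i , 1≤fi with unique zero (suc i) 1≤f₀ 1≤fi
    ... | ()

  finiteFin : ∀ n → Finite (Fin n)
  finiteFin n = record
    { ∑ = sum ; ∑-mono-≤ = sum-mono-≤ n ; ∑-distrib-+ = sum-distrib-+ ; ∑-zero = sum-zero n
    ; ∑-<⇒∃< = sum-<⇒∃< n ; ∑-≤1 = sum-≤1 n }

  size-finiteFin : ∀ n → size (finiteFin n) ≡ n
  size-finiteFin zero    = refl
  size-finiteFin (suc n) = cong suc (size-finiteFin n)

  term≤sum : ∀ n (f : Fin n → ℕ) i → f i ≤ sum f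
  term≤sum (suc n) f zero    = m≤m+n _ _
  term≤sum (suc n) f (suc i) = ≤-trans (term≤sum n (f ∘ suc) i) (m≤n+m _ _)

  finite⊤ : Finite ⊤
  finite⊤ = record
    { ∑ = λ f → f tt ; ∑-mono-≤ = λ f≤g → f≤g tt ; ∑-distrib-+ = λ _ _ → refl ; ∑-zero = refl
    ; ∑-<⇒∃< = λ lt → tt , lt ; ∑-≤1 = λ f≤1 _ → f≤1 tt }

  finite⊥ : Finite ⊥
  finite⊥ = record
    { ∑ = λ _ → 0 ; ∑-mono-≤ = λ _ → z≤n ; ∑-distrib-+ = λ _ _ → refl ; ∑-zero = refl
    ; ∑-<⇒∃< = λ () ; ∑-≤1 = λ _ _ → z≤n }

  module _ {A B : Set} (FA : Finite A) (FB : Finite B) where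
    private
      module A = Finite FA
      module B = Finite FB

    finite⊎ : Finite (A ⊎ B)
    finite⊎ = record
      { ∑ = λ f → A.∑ (f ∘ inj₁) + B.∑ (f ∘ inj₂)
      ; ∑-mono-≤ = λ f≤g → +-mono-≤ (A.∑-mono-≤ (f≤g ∘ inj₁)) (B.∑-mono-≤ (f≤g ∘ inj₂))
      ; ∑-distrib-+ = λ f g →
          trans (cong₂ _+_ (A.∑-distrib-+ (f ∘ inj₁) (g ∘ inj₁)) (B.∑-distrib-+ (f ∘ inj₂) (g ∘ inj₂)))
                (interchange (A.∑ (f ∘ inj₁)) (A.∑ (g ∘ inj₁)) (B.∑ (f ∘ inj₂)) (B.∑ (g ∘ inj₂)))
      ; ∑-zero = cong₂ _+_ A.∑-zero B.∑-zero
      ; ∑-<⇒∃< = <⇒∃<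
      ; ∑-≤1 = λ f≤1 unique → +-≤1 (A.∑-≤1 (f≤1 ∘ inj₁) λ a b p q → inj₁-injective (unique _ _ p q))
                                    (B.∑-≤1 (f≤1 ∘ inj₂) λ a b p q → inj₂-injective (unique _ _ p q))
                                    (disjoint unique)
      }
      where
      <⇒∃< : ∀ {f g : A ⊎ B → ℕ} → A.∑ (f ∘ inj₁) + B.∑ (f ∘ inj₂) < A.∑ (g ∘ inj₁) + B.∑ (g ∘ inj₂) →
             ∃ λ x → f x < g x
      <⇒∃< lt with +-<⇒⊎ lt
      ... | inj₁ ltA = let a , fa<ga = A.∑-<⇒∃< ltA in inj₁ a , fa<ga
      ... | inj₂ ltB = let b , fb<gb = B.∑-<⇒∃< ltB in inj₂ b , fb<gb
      disjoint : ∀ {f : A ⊎ B → ℕ} → (∀ x y → 1 ≤ f x → 1 ≤ f y → x ≡ y) →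
                 1 ≤ A.∑ (f ∘ inj₁) → 1 ≤ B.∑ (f ∘ inj₂) → ⊥
      disjoint unique 1≤∑A 1≤∑B with A.∑-positive⇒∃ 1≤∑A | B.∑-positive⇒∃ 1≤∑B
      ... | a , 1≤fa | b , 1≤fb with unique (inj₁ a) (inj₂ b) 1≤fa 1≤fb
      ... | ()

    finite× : Finite (A × B)
    finite× = record
      { ∑ = λ f → A.∑ (λ a → B.∑ (λ b → f (a , b)))
      ; ∑-mono-≤ = λ f≤g → A.∑-mono-≤ (λ a → B.∑-mono-≤ (λ b → f≤g (a , b)))
      ; ∑-distrib-+ = λ f g →
          trans (A.∑-cong (λ a → B.∑-distrib-+ (λ b → f (a , b)) (λ b → g (a , b)))) (A.∑-distrib-+ _ _)
      ; ∑-zero = trans (A.∑-cong (λ _ → B.∑-zero)) A.∑-zero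
      ; ∑-<⇒∃< = <⇒∃<
      ; ∑-≤1 = ≤1
      }
      where
      <⇒∃< : ∀ {f g : A × B → ℕ} → A.∑ (λ a → B.∑ (λ b → f (a , b))) < A.∑ (λ a → B.∑ (λ b → g (a , b))) →
             ∃ λ x → f x < g x
      <⇒∃< lt with A.∑-<⇒∃< lt
      ... | a , ltB with B.∑-<⇒∃< ltB
      ...   | b , fab<gab = (a , b) , fab<gab
      ≤1 : ∀ {f : A × B → ℕ} → (∀ x → f x ≤ 1) → (∀ x y → 1 ≤ f x → 1 ≤ f y → x ≡ y) →
           A.∑ (λ a → B.∑ (λ b → f (a , b))) ≤ 1
      ≤1 {f} f≤1 unique = A.∑-≤1 row≤1 rows-unique
        where
        row≤1 : ∀ a → B.∑ (λ b → f (a , b)) ≤ 1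
        row≤1 a = B.∑-≤1 (λ b → f≤1 (a , b)) (λ b b′ p p′ → cong proj₂ (unique (a , b) (a , b′) p p′))
        rows-unique : ∀ a a′ → 1 ≤ B.∑ (λ b → f (a , b)) → 1 ≤ B.∑ (λ b → f (a′ , b)) → a ≡ a′
        rows-unique a a′ p p′ with B.∑-positive⇒∃ p | B.∑-positive⇒∃ p′
        ... | b , pb | b′ , pb′ = cong proj₁ (unique (a , b) (a′ , b′) pb pb′)

  module _ {A : Set} (FA : Finite A) where
    private
      module A = Finite FA

    ∑-comm-sum : ∀ n (h : A → Fin n → ℕ) → A.∑ (λ a → sum (h a)) ≡ sum (λ j → A.∑ (λ a → h a j))
    ∑-comm-sum zero    h = A.∑-zero
    ∑-comm-sum (suc n) h =
      trans (A.∑-distrib-+ _ _) (cong (A.∑ (λ a → h a zero) +_) (∑-comm-sum n (λ a j → h a (suc j))))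

    injective⇒size≤ : ∀ {n} (g : A → Fin n) → Injective _≡_ _≡_ g → A.size ≤ n
    injective⇒size≤ {n} g g-inj = begin
      A.size                                     ≤⟨ A.∑-mono-≤ hit ⟩
      A.∑ (λ a → sum (λ j → 𝟙 (g a Finₚ.≟ j)))   ≡⟨ ∑-comm-sum n _ ⟩
      sum (λ j → A.∑ (λ a → 𝟙 (g a Finₚ.≟ j)))   ≤⟨ sum-mono-≤ n fibre≤1 ⟩
      sum {n} (λ _ → 1)                          ≡⟨ size-finiteFin n ⟩
      n                                          ∎
      where
      open ≤-Reasoning
      hit : ∀ a → 1 ≤ sum (λ j → 𝟙 (g a Finₚ.≟ j))
      hit a = ≤-trans (≤-reflexive (sym (𝟙-yes (g a Finₚ.≟ g a) refl))) (term≤sum n _ (g a))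
      fibre≤1 : ∀ j → A.∑ (λ a → 𝟙 (g a Finₚ.≟ j)) ≤ 1
      fibre≤1 j = A.∑-𝟙-≤1 (λ a → g a Finₚ.≟ j) (λ a b ga≡j gb≡j → g-inj (trans ga≡j (sym gb≡j)))

  sum≡0⇒≡0 : ∀ n {f : Fin n → ℕ} → sum f ≡ 0 → ∀ i → f i ≡ 0
  sum≡0⇒≡0 n {f} ∑f≡0 i = n≤0⇒n≡0 (≤-trans (term≤sum n f i) (≤-reflexive ∑f≡0))

open FiniteSum

open import Data.Nat as ℕ using (ℕ; zero; suc; _≤_; _<_; z≤n; s≤s)
import Data.Nat.Properties as ℕₚ
open import Data.Fin using (Fin; zero; suc; punchIn; punchOut)
import Data.Fin.Properties as Finₚ
open import Data.Product using (∃; _×_; _,_; proj₁; proj₂)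
open import Data.Sum using (_⊎_; inj₁; inj₂)
open import Data.Unit using (⊤; tt)
open import Data.Empty using (⊥; ⊥-elim)
open import Data.Vec.Functional using ([]; _∷_; head; tail)
open import Function using (_∘_)
open import Function.Definitions using (Injective)
open import Relation.Nullary using (¬_; Dec; yes; no)
open import Relation.Nullary.Decidable using (map′; ¬?; decidable-stable; _×-dec_)
open import Relation.Binary.PropositionalEquality as ≡ using (_≡_)
open import Algebra.Bundles using (CommutativeRing)
import Relation.Binary.Reasoning.Setoid
open import Data.Nat.Tactic.RingSolver using (solve-∀)

module ProjectiveSpace {c ℓ : Level} (F : CommutativeRing c ℓ) (isField : IsFieldRing F)
                       (q : ℕ) (order : HasOrder F q) where

  open CommutativeRing F hiding (zero)
  open IsFieldRing isField
  open HasOrder order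
  open Linear F
  open import Algebra.Properties.Ring ring using (-‿distribˡ-*; -‿distribʳ-*)
  open import Algebra.Properties.Group +-group
    using (⁻¹-involutive; inverseʳ-unique) renaming (∙-cancelˡ to +-cancelˡ)
  open import Algebra.Properties.CommutativeSemigroup *-commutativeSemigroup using (x∙yz≈y∙xz)
  open import Algebra.Properties.Semiring.Sum semiring
    using (sum; sum-cong-≋; sum-replicate-zero; *-distribˡ-sum; *-distribʳ-sum)
    renaming (∑-distrib-+ to sum-distrib-+; ∑-comm to sum-comm)
  module ≈-Reasoning = Relation.Binary.Reasoning.Setoid setoid

  1≉0 : ¬ 1# ≈ 0#
  1≉0 1≈0 = 0#≉1# (sym 1≈0)

  index : Carrier → Fin q
  index x = proj₁ (enum-surjective x)

  enum-index : ∀ x → enum (index x) ≈ x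
  enum-index x = proj₂ (enum-surjective x)

  infix 4 _≟_
  _≟_ : (x y : Carrier) → Dec (x ≈ y)
  x ≟ y = map′ (λ i≡j → trans (sym (enum-index x)) (trans (reflexive (≡.cong enum i≡j)) (enum-index y)))
               (λ x≈y → enum-injective _ _ (trans (enum-index x) (trans x≈y (sym (enum-index y)))))
               (index x Finₚ.≟ index y)

  *-cancelˡ : ∀ a {b c} → ¬ a ≈ 0# → a * b ≈ a * c → b ≈ c
  *-cancelˡ a {b} {c} a≉0 ab≈ac = begin
    b              ≈⟨ *-identityˡ b ⟨
    1# * b         ≈⟨ *-congʳ a⁻¹a≈1 ⟨
    (a⁻¹ * a) * b  ≈⟨ *-assoc a⁻¹ a b ⟩
    a⁻¹ * (a * b)  ≈⟨ *-congˡ ab≈ac ⟩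
    a⁻¹ * (a * c)  ≈⟨ *-assoc a⁻¹ a c ⟨
    (a⁻¹ * a) * c  ≈⟨ *-congʳ a⁻¹a≈1 ⟩
    1# * c         ≈⟨ *-identityˡ c ⟩
    c              ∎
    where
    open ≈-Reasoning
    a⁻¹ : Carrier
    a⁻¹ = proj₁ (inverse a a≉0)
    a⁻¹a≈1 : a⁻¹ * a ≈ 1#
    a⁻¹a≈1 = trans (*-comm a⁻¹ a) (proj₂ (inverse a a≉0))

  NonZero : ∀ {k} → Vect k → Set ℓ
  NonZero {k} v = ∃ λ (i : Fin k) → ¬ v i ≈ 0#

  nonZero? : ∀ {k} (v : Vect k) → Dec (NonZero v)
  nonZero? v = Finₚ.any? (λ i → ¬? (v i ≟ 0#))

  ¬nonZero⇒≈0 : ∀ {k} (v : Vect k) → ¬ NonZero v → v ≈ᵥ zeroᵥ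
  ¬nonZero⇒≈0 v ¬nz i = decidable-stable (v i ≟ 0#) (λ vi≉0 → ¬nz (i , vi≉0))

  nonZero∧tail≈0⇒head≉0 : ∀ {k} (p : Vect (suc k)) → NonZero p → tail p ≈ᵥ zeroᵥ → ¬ head p ≈ 0#
  nonZero∧tail≈0⇒head≉0 p (zero  , p₀≉0) _      = p₀≉0
  nonZero∧tail≈0⇒head≉0 p (suc i , pᵢ≉0) tail≈0 = ⊥-elim (pᵢ≉0 (tail≈0 i))

  infix 4 _≟ᵥ_
  _≟ᵥ_ : ∀ {k} (u v : Vect k) → Dec (u ≈ᵥ v)
  u ≟ᵥ v = Finₚ.all? (λ i → u i ≟ v i)

  dot : ∀ {k} → Vect k → Vect k → Carrier
  dot u v = sum (λ i → u i * v i)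

  module _ {k : ℕ} where

    dot-cong : ∀ {u u′ v v′ : Vect k} → u ≈ᵥ u′ → v ≈ᵥ v′ → dot u v ≈ dot u′ v′
    dot-cong u≈u′ v≈v′ = sum-cong-≋ (λ i → *-cong (u≈u′ i) (v≈v′ i))

    dot-comm : ∀ (u v : Vect k) → dot u v ≈ dot v u
    dot-comm u v = sum-cong-≋ (λ i → *-comm (u i) (v i))

    dot-zeroʳ : ∀ (u : Vect k) {v} → v ≈ᵥ zeroᵥ → dot u v ≈ 0#
    dot-zeroʳ u v≈0 = trans (sum-cong-≋ (λ i → trans (*-congˡ (v≈0 i)) (zeroʳ (u i)))) (sum-replicate-zero k)

    dot-distribˡ-+ : ∀ (u v w : Vect k) → dot u (v +ᵥ w) ≈ dot u v + dot u w
    dot-distribˡ-+ u v w =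
      trans (sum-cong-≋ (λ i → distribˡ (u i) (v i) (w i))) (sum-distrib-+ (λ i → u i * v i) (λ i → u i * w i))

    dot-*ʳ : ∀ (u : Vect k) a v → dot u (a ·ᵥ v) ≈ a * dot u v
    dot-*ʳ u a v = trans (sum-cong-≋ (λ i → x∙yz≈y∙xz (u i) a (v i))) (sym (*-distribˡ-sum a (λ i → u i * v i)))

  dot-0∷ʳ : ∀ {k} (u : Vect (suc k)) v → dot u (0# ∷ v) ≈ dot (tail u) v
  dot-0∷ʳ u v = trans (+-congʳ (zeroʳ (head u))) (+-identityˡ _)

  dot-0∷ˡ : ∀ {k} u (v : Vect (suc k)) → dot (0# ∷ u) v ≈ dot u (tail v)
  dot-0∷ˡ u v = trans (+-congʳ (zeroˡ (head v))) (+-identityˡ _)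

  dot-assoc : ∀ {m n} (x : Vect m) (M : Fin m → Vect n) (y : Vect n) →
              dot x (λ i → dot (M i) y) ≈ dot (λ j → dot x (λ i → M i j)) y
  dot-assoc x M y = begin
    sum (λ i → x i * sum (λ j → M i j * y j))
      ≈⟨ sum-cong-≋ (λ i → *-distribˡ-sum (x i) (λ j → M i j * y j)) ⟩
    sum (λ i → sum (λ j → x i * (M i j * y j)))
      ≈⟨ sum-comm (λ i j → x i * (M i j * y j)) ⟩
    sum (λ j → sum (λ i → x i * (M i j * y j)))
      ≈⟨ sum-cong-≋ (λ j → sum-cong-≋ (λ i → *-assoc (x i) (M i j) (y j))) ⟨
    sum (λ j → sum (λ i → (x i * M i j) * y j))
      ≈⟨ sum-cong-≋ (λ j → *-distribʳ-sum (y j) (λ i → x i * M i j)) ⟨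
    sum (λ j → sum (λ i → x i * M i j) * y j)
      ∎
    where open ≈-Reasoning

  lincomb-coord : ∀ {k v} (cs : Vect k) (bs : Fin k → Vect v) j → lincomb cs bs j ≡ dot cs (λ i → bs i j)
  lincomb-coord {zero}  cs bs j = ≡.refl
  lincomb-coord {suc k} cs bs j = ≡.cong (cs zero * bs zero j +_) (lincomb-coord (tail cs) (tail bs) j)

  dot-lincomb : ∀ {k v} (f : Vect v) (cs : Vect k) (bs : Fin k → Vect v) →
                dot f (lincomb cs bs) ≈ dot cs (λ i → dot f (bs i))
  dot-lincomb f cs bs = begin
    dot f (lincomb cs bs)                  ≈⟨ dot-cong (λ _ → refl) (reflexive ∘ lincomb-coord cs bs) ⟩
    dot f (λ j → dot cs (λ i → bs i j))    ≈⟨ dot-comm f _ ⟩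
    dot (λ j → dot cs (λ i → bs i j)) f    ≈⟨ dot-assoc cs bs f ⟨
    dot cs (λ i → dot (bs i) f)            ≈⟨ dot-cong (λ _ → refl) (λ i → dot-comm (bs i) f) ⟩
    dot cs (λ i → dot f (bs i))            ∎
    where open ≈-Reasoning

  lincomb-lincomb : ∀ {k m v} (cs : Vect k) (M : Fin k → Vect m) (bs : Fin m → Vect v) →
                    lincomb cs (λ t → lincomb (M t) bs) ≈ᵥ lincomb (λ i → dot cs (λ t → M t i)) bs
  lincomb-lincomb cs M bs j = begin
    lincomb cs (λ t → lincomb (M t) bs) j
      ≡⟨ lincomb-coord cs _ j ⟩
    dot cs (λ t → lincomb (M t) bs j)
      ≈⟨ dot-cong (λ _ → refl) (λ t → reflexive (lincomb-coord (M t) bs j)) ⟩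
    dot cs (λ t → dot (M t) (λ i → bs i j))
      ≈⟨ dot-assoc cs M (λ i → bs i j) ⟩
    dot (λ i → dot cs (λ t → M t i)) (λ i → bs i j)
      ≡⟨ lincomb-coord _ bs j ⟨
    lincomb (λ i → dot cs (λ t → M t i)) bs j
      ∎
    where open ≈-Reasoning

  ∈Span-⊥ : ∀ {k v} (f x : Vect v) (bs : Fin k → Vect v) →
            x ∈Span bs → (∀ i → dot f (bs i) ≈ 0#) → dot f x ≈ 0#
  ∈Span-⊥ f x bs (cs , x≈) f⊥bs = begin
    dot f x                       ≈⟨ dot-cong (λ _ → refl) x≈ ⟩
    dot f (lincomb cs bs)         ≈⟨ dot-lincomb f cs bs ⟩
    dot cs (λ i → dot f (bs i))   ≈⟨ dot-zeroʳ cs f⊥bs ⟩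
    0#                            ∎
    where open ≈-Reasoning

  independent-lincomb : ∀ {k m v} {M : Fin k → Vect m} {bs : Fin m → Vect v} →
                        Independent M → Independent bs → Independent (λ t → lincomb (M t) bs)
  independent-lincomb {M = M} {bs} M-indep bs-indep cs cs∘M∘bs≈0 =
    M-indep cs (λ i → trans (reflexive (lincomb-coord cs M i)) (bs-indep _ cs∘M≈0 i))
    where
    cs∘M≈0 : lincomb (λ i → dot cs (λ t → M t i)) bs ≈ᵥ zeroᵥ
    cs∘M≈0 j = trans (sym (lincomb-lincomb cs M bs j)) (cs∘M∘bs≈0 j)

  δ : ∀ {k} → Fin k → Vect k
  δ zero    = 1# ∷ zeroᵥ
  δ (suc i) = 0# ∷ δ i

  δ-sym : ∀ {k} (i j : Fin k) → δ i j ≡ δ j i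
  δ-sym zero    zero    = ≡.refl
  δ-sym zero    (suc j) = ≡.refl
  δ-sym (suc i) zero    = ≡.refl
  δ-sym (suc i) (suc j) = δ-sym i j

  dot-δ : ∀ {k} (u : Vect k) i → dot u (δ i) ≈ u i
  dot-δ u zero    =
    trans (+-cong (*-identityʳ (head u)) (dot-zeroʳ (tail u) (λ _ → refl))) (+-identityʳ (head u))
  dot-δ u (suc i) = trans (dot-0∷ʳ u (δ i)) (dot-δ (tail u) i)

  δ-diagonal : ∀ {k} (i : Fin k) → δ i i ≡ 1#
  δ-diagonal zero    = ≡.refl
  δ-diagonal (suc i) = δ-diagonal i

  independent⇒nonZero : ∀ {k v} {bs : Fin k → Vect v} → Independent bs → ∀ i → NonZero (bs i)
  independent⇒nonZero {bs = bs} bs-indep i with nonZero? (bs i)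
  ... | yes bᵢ≢0 = bᵢ≢0
  ... | no ¬bᵢ≢0 = ⊥-elim (1≉0 (trans (reflexive (≡.sym (δ-diagonal i))) (bs-indep (δ i) δᵢ·bs≈0 i)))
    where
    δᵢ·bs≈0 : lincomb (δ i) bs ≈ᵥ zeroᵥ
    δᵢ·bs≈0 j = trans (reflexive (lincomb-coord (δ i) bs j))
                      (trans (dot-comm (δ i) _) (trans (dot-δ (λ t → bs t j) i) (¬nonZero⇒≈0 (bs i) ¬bᵢ≢0 j)))

  -- Gaussian elimination of the first coordinate of every b i against the pivot b t.
  eliminate : ∀ {m n} (b : Fin (suc m) → Vect (suc n)) (t : Fin (suc m)) → Fin m → Vect n
  eliminate b t j = tail ((head (b t) ·ᵥ b (punchIn t j)) +ᵥ ((- head (b (punchIn t j))) ·ᵥ b t))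

  ⊥-eliminate⇒∃-⊥ : ∀ {m n} (b : Fin (suc m) → Vect (suc n)) t → ¬ head (b t) ≈ 0# →
    (g : Vect n) → (∀ j → dot g (eliminate b t j) ≈ 0#) → ∃ λ x → ∀ i → dot (x ∷ g) (b i) ≈ 0#
  ⊥-eliminate⇒∃-⊥ {m} {n} b t hₜ≉0 g g⊥ = x , f⊥b
    where
    open ≈-Reasoning
    h : Fin (suc m) → Carrier
    h i = head (b i)
    hₜ⁻¹ : Carrier
    hₜ⁻¹ = proj₁ (inverse (h t) hₜ≉0)
    x : Carrier
    x = - dot g (tail (b t)) * hₜ⁻¹
    f : Vect (suc n)
    f = x ∷ g
    w : Fin (suc m) → Vect (suc n)
    w i = (h t ·ᵥ b i) +ᵥ ((- h i) ·ᵥ b t)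
    f⊥bₜ : dot f (b t) ≈ 0#
    f⊥bₜ = begin
      - G * hₜ⁻¹ * h t + G      ≈⟨ +-congʳ (*-assoc (- G) hₜ⁻¹ (h t)) ⟩
      - G * (hₜ⁻¹ * h t) + G    ≈⟨ +-congʳ (*-congˡ (trans (*-comm hₜ⁻¹ (h t)) (proj₂ (inverse (h t) hₜ≉0)))) ⟩
      - G * 1# + G              ≈⟨ +-congʳ (*-identityʳ (- G)) ⟩
      - G + G                   ≈⟨ -‿inverseˡ G ⟩
      0#                        ∎
      where
      G : Carrier
      G = dot g (tail (b t))
    f·w : ∀ i → dot f (w i) ≈ h t * dot f (b i)
    f·w i = begin
      dot f (w i)                                   ≈⟨ dot-distribˡ-+ f (h t ·ᵥ b i) ((- h i) ·ᵥ b t) ⟩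
      dot f (h t ·ᵥ b i) + dot f ((- h i) ·ᵥ b t)   ≈⟨ +-cong (dot-*ʳ f (h t) (b i)) (dot-*ʳ f (- h i) (b t)) ⟩
      h t * dot f (b i) + - h i * dot f (b t)       ≈⟨ +-congˡ (trans (*-congˡ f⊥bₜ) (zeroʳ (- h i))) ⟩
      h t * dot f (b i) + 0#                        ≈⟨ +-identityʳ _ ⟩
      h t * dot f (b i)                             ∎
    w-head≈0 : ∀ i → head (w i) ≈ 0#
    w-head≈0 i = trans (+-congˡ (trans (sym (-‿distribˡ-* (h i) (h t))) (-‿cong (*-comm (h i) (h t)))))
                       (-‿inverseʳ (h t * h i))
    f⊥w : ∀ j → dot f (w (punchIn t j)) ≈ 0#
    f⊥w j = trans (+-cong (trans (*-congˡ (w-head≈0 (punchIn t j))) (zeroʳ x)) (g⊥ j)) (+-identityʳ 0#)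
    f⊥b : ∀ i → dot f (b i) ≈ 0#
    f⊥b i with i Finₚ.≟ t
    ... | yes ≡.refl = f⊥bₜ
    ... | no i≢t = *-cancelˡ (h t) hₜ≉0 (begin
      h t * dot f (b i)                      ≈⟨ f·w i ⟨
      dot f (w i)                            ≡⟨ ≡.cong (dot f ∘ w) (Finₚ.punchIn-punchOut t≢i) ⟨
      dot f (w (punchIn t (punchOut t≢i)))   ≈⟨ f⊥w (punchOut t≢i) ⟩
      0#                                     ≈⟨ zeroʳ (h t) ⟨
      h t * 0#                               ∎)
      where
      t≢i : ¬ t ≡ i
      t≢i t≡i = i≢t (≡.sym t≡i)

  ∃-orthogonal : ∀ {m n} → m < n → (b : Fin m → Vect n) → ∃ λ f → NonZero f × ∀ i → dot f (b i) ≈ 0#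
  ∃-orthogonal {zero}  {suc n} _ b = δ zero , (zero , 1≉0) , λ ()
  ∃-orthogonal {suc m} {suc n} (s≤s m<n) b with Finₚ.any? (λ t → ¬? (head (b t) ≟ 0#))
  ... | no ∄pivot = δ zero , (zero , 1≉0) , λ i →
    trans (dot-comm (δ zero) (b i)) (trans (dot-δ (b i) zero)
          (decidable-stable (head (b i) ≟ 0#) (λ bᵢ≉0 → ∄pivot (i , bᵢ≉0))))
  ... | yes (t , hₜ≉0) =
    let g , (i , gᵢ≉0) , g⊥ = ∃-orthogonal m<n (eliminate b t)
        x , f⊥b          = ⊥-eliminate⇒∃-⊥ b t hₜ≉0 g g⊥
    in x ∷ g , (suc i , gᵢ≉0) , f⊥b

  -- Points of PG(k,q)

  Coords : ℕ → Set
  Coords zero    = ⊤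
  Coords (suc k) = Fin q × Coords k

  coords : ∀ {k} → Coords k → Vect k
  coords {suc k} (x , t) = enum x ∷ coords t

  coords-injective : ∀ {k} (t u : Coords k) → coords t ≈ᵥ coords u → t ≡ u
  coords-injective {zero}  tt      tt      _   = ≡.refl
  coords-injective {suc k} (x , t) (y , u) t≈u =
    ≡.cong₂ _,_ (enum-injective x y (t≈u zero)) (coords-injective t u (t≈u ∘ suc))

  -- The points of PG(k,q), as the vectors of F^(k+1) whose first nonzero entry is 1:
  -- either (1 , x) with x ∈ F^k, or (0 , p) with p a point of PG(k-1,q).
  PG    : ℕ → Set
  Below : ℕ → Set
  PG k = Coords k ⊎ Below k
  Below zero    = ⊥
  Below (suc k) = PG k

  vec : ∀ {k} → PG k → Vect (suc k)
  vec (inj₁ x)         = 1# ∷ coords x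
  vec {suc k} (inj₂ p) = 0# ∷ vec p

  hyperplaneBasis : ∀ {k} → PG k → Fin k → Vect (suc k)
  hyperplaneBasis (inj₁ x)         i       = (- coords x i) ∷ δ i
  hyperplaneBasis {suc k} (inj₂ p) zero    = δ zero
  hyperplaneBasis {suc k} (inj₂ p) (suc i) = 0# ∷ hyperplaneBasis p i

  -- A linear embedding of F^k onto a complement of the line spanned by vec a.
  complement : ∀ {k} → PG k → Vect k → Vect (suc k)
  complement (inj₁ x)         u = 0# ∷ u
  complement {suc k} (inj₂ p) u = head u ∷ complement p (tail u)

  vec-⊥-hyperplaneBasis : ∀ {k} (a : PG k) i → dot (vec a) (hyperplaneBasis a i) ≈ 0#
  vec-⊥-hyperplaneBasis (inj₁ x) i =
    trans (+-cong (*-identityˡ _) (dot-δ (coords x) i)) (-‿inverseˡ (coords x i))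
  vec-⊥-hyperplaneBasis {suc k} (inj₂ p) zero    = dot-δ (vec (inj₂ p)) zero
  vec-⊥-hyperplaneBasis {suc k} (inj₂ p) (suc i) =
    trans (dot-0∷ʳ (vec (inj₂ p)) (hyperplaneBasis p i)) (vec-⊥-hyperplaneBasis p i)

  ⊥-hyperplaneBasis⇒multiple : ∀ {k} (a : PG k) (f : Vect (suc k)) →
    (∀ i → dot f (hyperplaneBasis a i) ≈ 0#) → ∃ λ ν → f ≈ᵥ (ν ·ᵥ vec a)
  ⊥-hyperplaneBasis⇒multiple (inj₁ x) f f⊥ = head f , coordinate
    where
    coordinate : ∀ i → f i ≈ head f * vec (inj₁ x) i
    coordinate zero    = sym (*-identityʳ (head f))
    coordinate (suc i) = begin
      f (suc i)                   ≈⟨ inverseʳ-unique _ _ (trans (+-congˡ (sym (dot-δ (tail f) i))) (f⊥ i)) ⟩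
      - (head f * - coords x i)   ≈⟨ -‿cong (-‿distribʳ-* (head f) (coords x i)) ⟨
      - - (head f * coords x i)   ≈⟨ ⁻¹-involutive _ ⟩
      head f * coords x i         ∎
      where open ≈-Reasoning
  ⊥-hyperplaneBasis⇒multiple {suc k} (inj₂ p) f f⊥ with
    ⊥-hyperplaneBasis⇒multiple p (tail f) (λ i → trans (sym (dot-0∷ʳ f (hyperplaneBasis p i))) (f⊥ (suc i)))
  ... | ν , tail≈ = ν , coordinate
    where
    coordinate : ∀ i → f i ≈ ν * vec (inj₂ p) i
    coordinate zero    = trans (sym (dot-δ f zero)) (trans (f⊥ zero) (sym (zeroʳ ν)))
    coordinate (suc i) = tail≈ i

  hyperplaneBasis-independent : ∀ {k} (a : PG k) → Independent (hyperplaneBasis a)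
  hyperplaneBasis-independent (inj₁ x) cs lin≈0 i = begin
    cs i                                                 ≈⟨ dot-δ cs i ⟨
    dot cs (δ i)                                         ≈⟨ dot-cong (λ _ → refl) (λ t → reflexive (δ-sym i t)) ⟩
    dot cs (λ t → hyperplaneBasis (inj₁ x) t (suc i))    ≡⟨ lincomb-coord cs (hyperplaneBasis (inj₁ x)) (suc i) ⟨
    lincomb cs (hyperplaneBasis (inj₁ x)) (suc i)        ≈⟨ lin≈0 (suc i) ⟩
    0#                                                   ∎
    where open ≈-Reasoning
  hyperplaneBasis-independent {suc k} (inj₂ p) cs lin≈0 zero =
    trans (sym (dot-δ cs zero))
          (trans (reflexive (≡.sym (lincomb-coord cs (hyperplaneBasis (inj₂ p)) zero))) (lin≈0 zero))
  hyperplaneBasis-independent {suc k} (inj₂ p) cs lin≈0 (suc i) =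
    hyperplaneBasis-independent p (tail cs) tail-lin≈0 i
    where
    tail-lin≈0 : lincomb (tail cs) (hyperplaneBasis p) ≈ᵥ zeroᵥ
    tail-lin≈0 j = begin
      lincomb (tail cs) (hyperplaneBasis p) j              ≡⟨ lincomb-coord (tail cs) (hyperplaneBasis p) j ⟩
      dot (tail cs) (λ t → hyperplaneBasis p t j)          ≈⟨ dot-0∷ʳ cs (λ t → hyperplaneBasis p t j) ⟨
      dot cs (λ t → hyperplaneBasis (inj₂ p) t (suc j))    ≡⟨ lincomb-coord cs (hyperplaneBasis (inj₂ p)) (suc j) ⟨
      lincomb cs (hyperplaneBasis (inj₂ p)) (suc j)        ≈⟨ lin≈0 (suc j) ⟩
      0#                                                   ∎
      where open ≈-Reasoning

  ·vec≈0⇒≈0 : ∀ {k} (a : PG k) {λ₀} → (λ₀ ·ᵥ vec a) ≈ᵥ zeroᵥ → λ₀ ≈ 0#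
  ·vec≈0⇒≈0 (inj₁ x)         {λ₀} λa≈0 = trans (sym (*-identityʳ λ₀)) (λa≈0 zero)
  ·vec≈0⇒≈0 {suc k} (inj₂ p) λa≈0      = ·vec≈0⇒≈0 p (λa≈0 ∘ suc)

  ·vec-injective : ∀ {k} (a b : PG k) {λ₀ μ} → ¬ λ₀ ≈ 0# → ¬ μ ≈ 0# →
                   (λ₀ ·ᵥ vec a) ≈ᵥ (μ ·ᵥ vec b) → a ≡ b
  ·vec-injective (inj₁ x) (inj₁ y) {λ₀} {μ} λ₀≉0 _ λa≈μb =
    ≡.cong inj₁ (coords-injective x y (λ i → *-cancelˡ λ₀ λ₀≉0 (trans (λa≈μb (suc i)) (*-congʳ (sym λ₀≈μ)))))
    where
    λ₀≈μ : λ₀ ≈ μ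
    λ₀≈μ = trans (sym (*-identityʳ λ₀)) (trans (λa≈μb zero) (*-identityʳ μ))
  ·vec-injective {suc k} (inj₁ x) (inj₂ p) {λ₀} {μ} λ₀≉0 _ λa≈μb =
    ⊥-elim (λ₀≉0 (trans (sym (*-identityʳ λ₀)) (trans (λa≈μb zero) (zeroʳ μ))))
  ·vec-injective {suc k} (inj₂ p) (inj₁ y) {λ₀} {μ} _ μ≉0 λa≈μb =
    ⊥-elim (μ≉0 (trans (sym (*-identityʳ μ)) (trans (sym (λa≈μb zero)) (zeroʳ λ₀))))
  ·vec-injective {suc k} (inj₂ p) (inj₂ p′) λ₀≉0 μ≉0 λa≈μb =
    ≡.cong inj₂ (·vec-injective p p′ λ₀≉0 μ≉0 (λa≈μb ∘ suc))

  complement-zero : ∀ {k} (a : PG k) → complement a zeroᵥ ≈ᵥ zeroᵥ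
  complement-zero (inj₁ x)         zero    = refl
  complement-zero (inj₁ x)         (suc i) = refl
  complement-zero {suc k} (inj₂ p) zero    = refl
  complement-zero {suc k} (inj₂ p) (suc i) = complement-zero p i

  complement-* : ∀ {k} (a : PG k) β u → complement a (β ·ᵥ u) ≈ᵥ (β ·ᵥ complement a u)
  complement-* (inj₁ x)         β u zero    = sym (zeroʳ β)
  complement-* (inj₁ x)         β u (suc i) = refl
  complement-* {suc k} (inj₂ p) β u zero    = refl
  complement-* {suc k} (inj₂ p) β u (suc i) = complement-* p β (tail u) i

  complement-unique : ∀ {k} (a : PG k) {α α′ u u′} →
    ((α ·ᵥ vec a) +ᵥ complement a u) ≈ᵥ ((α′ ·ᵥ vec a) +ᵥ complement a u′) → α ≈ α′ × u ≈ᵥ u′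
  complement-unique (inj₁ x) {α} {α′} {u} {u′} eq = α≈α′ , u≈u′
    where
    α≈α′ : α ≈ α′
    α≈α′ = begin
      α                ≈⟨ *-identityʳ α ⟨
      α * 1#           ≈⟨ +-identityʳ _ ⟨
      α * 1# + 0#      ≈⟨ eq zero ⟩
      α′ * 1# + 0#     ≈⟨ +-identityʳ _ ⟩
      α′ * 1#          ≈⟨ *-identityʳ α′ ⟩
      α′               ∎
      where open ≈-Reasoning
    u≈u′ : u ≈ᵥ u′
    u≈u′ i = +-cancelˡ (α * coords x i) _ _ (trans (eq (suc i)) (+-congʳ (*-congʳ (sym α≈α′))))
  complement-unique {suc k} (inj₂ p) {α} {α′} {u} {u′} eq with complement-unique p (eq ∘ suc)
  ... | α≈α′ , tail-u≈u′ = α≈α′ , u≈u′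
    where
    u≈u′ : u ≈ᵥ u′
    u≈u′ zero    = +-cancelˡ (α * 0#) _ _ (trans (eq zero) (+-congʳ (trans (zeroʳ α′) (sym (zeroʳ α)))))
    u≈u′ (suc i) = tail-u≈u′ i

  -- The scalar is named by its index in the enumeration of F, which makes ∝ decidable.
  _∝_ : ∀ {k} → Vect (suc k) → PG k → Set ℓ
  u ∝ a = ∃ λ (i : Fin q) → ¬ enum i ≈ 0# × u ≈ᵥ (enum i ·ᵥ vec a)

  _∝?_ : ∀ {k} (u : Vect (suc k)) (a : PG k) → Dec (u ∝ a)
  u ∝? a = Finₚ.any? (λ i → ¬? (enum i ≟ 0#) ×-dec (u ≟ᵥ (enum i ·ᵥ vec a)))

  ∝-functional : ∀ {k} {u : Vect (suc k)} {a b} → u ∝ a → u ∝ b → a ≡ b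
  ∝-functional {a = a} {b} (i , i≉0 , u≈ia) (j , j≉0 , u≈jb) =
    ·vec-injective a b i≉0 j≉0 (λ t → trans (sym (u≈ia t)) (u≈jb t))

  multiple⇒∝ : ∀ {k} {u : Vect (suc k)} {ν a} → NonZero u → u ≈ᵥ (ν ·ᵥ vec a) → u ∝ a
  multiple⇒∝ {ν = ν} (t , ut≉0) u≈νa with ν ≟ 0#
  ... | yes ν≈0 = ⊥-elim (ut≉0 (trans (u≈νa t) (trans (*-congʳ ν≈0) (zeroˡ _))))
  ... | no ν≉0  = index ν , (λ iν≈0 → ν≉0 (trans (sym (enum-index ν)) iν≈0))
                          , (λ t → trans (u≈νa t) (*-congʳ (sym (enum-index ν))))

  ⊥-hyperplaneBasis⇒∝ : ∀ {k} (a : PG k) {f : Vect (suc k)} → NonZero f →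
    (∀ i → dot f (hyperplaneBasis a i) ≈ 0#) → f ∝ a
  ⊥-hyperplaneBasis⇒∝ a {f} f≢0 f⊥ = multiple⇒∝ {a = a} f≢0 (proj₂ (⊥-hyperplaneBasis⇒multiple a f f⊥))

  -- Counting

  finiteCoords : ∀ k → Finite (Coords k)
  finiteCoords zero    = finite⊤
  finiteCoords (suc k) = finite× (finiteFin q) (finiteCoords k)

  finitePG    : ∀ k → Finite (PG k)
  finiteBelow : ∀ k → Finite (Below k)
  finitePG k = finite⊎ (finiteCoords k) (finiteBelow k)
  finiteBelow zero    = finite⊥
  finiteBelow (suc k) = finitePG k

  size-Coords-suc : ∀ k → size (finiteCoords (suc k)) ≡ q ℕ.* size (finiteCoords k)
  size-Coords-suc k = ≡.trans (∑-const (finiteFin q) (size (finiteCoords k)))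
                              (≡.cong (ℕ._* size (finiteCoords k)) (size-finiteFin q))

  size-PG-suc : ∀ k → size (finitePG (suc k)) ≡ q ℕ.* size (finitePG k) ℕ.+ 1
  size-PG-suc zero    = ≡.cong (ℕ._+ 1) (size-Coords-suc zero)
  size-PG-suc (suc k) = begin
    size (finiteCoords (suc (suc k))) ℕ.+ size (finitePG (suc k))
      ≡⟨ ≡.cong₂ ℕ._+_ (size-Coords-suc (suc k)) (size-PG-suc k) ⟩
    q ℕ.* Cₖ ℕ.+ (q ℕ.* Pₖ ℕ.+ 1)
      ≡⟨ ℕₚ.+-assoc (q ℕ.* Cₖ) (q ℕ.* Pₖ) 1 ⟨
    q ℕ.* Cₖ ℕ.+ q ℕ.* Pₖ ℕ.+ 1
      ≡⟨ ≡.cong (ℕ._+ 1) (ℕₚ.*-distribˡ-+ q Cₖ Pₖ) ⟨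
    q ℕ.* (Cₖ ℕ.+ Pₖ) ℕ.+ 1
      ∎
    where
    open ≡.≡-Reasoning
    Cₖ Pₖ : ℕ
    Cₖ = size (finiteCoords (suc k))
    Pₖ = size (finitePG k)

  size-PG2 : size (finitePG 2) ≡ suc (q ℕ.* q ℕ.+ q)
  size-PG2 = ≡.trans (size-PG-suc 1) (≡.trans (≡.cong (λ n → q ℕ.* n ℕ.+ 1) (size-PG-suc 0)) (arithmetic q))
    where
    arithmetic : ∀ q → q ℕ.* (q ℕ.* 1 ℕ.+ 1) ℕ.+ 1 ≡ suc (q ℕ.* q ℕ.+ q)
    arithmetic = solve-∀

  affine-count : ∀ k c₀ (p : Vect (suc k)) → NonZero p →
    ∑ (finiteCoords (suc k)) (λ x → 𝟙 (c₀ + dot (coords x) p ≟ 0#)) ≤ size (finiteCoords k)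
  affine-count k c₀ p p≢0 with nonZero? (tail p)
  affine-count zero    c₀ p p≢0 | yes (() , _)
  affine-count (suc k) c₀ p p≢0 | yes tail≢0 = sum-mono-≤ q λ x₀ → begin
    ∑ (finiteCoords (suc k)) (λ t → 𝟙 (c₀ + (enum x₀ * head p + dot (coords t) (tail p)) ≟ 0#))
      ≡⟨ ∑-cong (finiteCoords (suc k)) (λ t → 𝟙-cong _ _ (trans (+-assoc _ _ _)) (trans (sym (+-assoc _ _ _)))) ⟩
    ∑ (finiteCoords (suc k)) (λ t → 𝟙 ((c₀ + enum x₀ * head p) + dot (coords t) (tail p) ≟ 0#))
      ≤⟨ affine-count k (c₀ + enum x₀ * head p) (tail p) tail≢0 ⟩
    size (finiteCoords k)
      ∎
    where open ℕₚ.≤-Reasoning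
  affine-count k c₀ p p≢0 | no ¬tail≢0 = begin
    ∑ (finiteFin q) (λ x₀ → ∑ (finiteCoords k) (λ t → 𝟙 (c₀ + (enum x₀ * head p + dot (coords t) (tail p)) ≟ 0#)))
      ≡⟨ ∑-cong (finiteFin q) (λ x₀ →
           ≡.trans (∑-cong (finiteCoords k) (hit x₀)) (∑-const (finiteCoords k) (root x₀))) ⟩
    ∑ (finiteFin q) (λ x₀ → S ℕ.* root x₀)
      ≡⟨ ∑-*ˡ (finiteFin q) S root ⟩
    S ℕ.* ∑ (finiteFin q) root
      ≤⟨ ℕₚ.*-monoʳ-≤ S (∑-𝟙-≤1 (finiteFin q) _ root-unique) ⟩
    S ℕ.* 1
      ≡⟨ ℕₚ.*-identityʳ S ⟩
    S
      ∎
    where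
    open ℕₚ.≤-Reasoning
    S : ℕ
    S = size (finiteCoords k)
    tail≈0 : tail p ≈ᵥ zeroᵥ
    tail≈0 = ¬nonZero⇒≈0 (tail p) ¬tail≢0
    root : Fin q → ℕ
    root x₀ = 𝟙 (c₀ + enum x₀ * head p ≟ 0#)
    hit : ∀ x₀ t → 𝟙 (c₀ + (enum x₀ * head p + dot (coords t) (tail p)) ≟ 0#) ≡ root x₀
    hit x₀ t = 𝟙-cong _ _ (trans (+-congˡ (sym drop))) (trans (+-congˡ drop))
      where
      drop : enum x₀ * head p + dot (coords t) (tail p) ≈ enum x₀ * head p
      drop = trans (+-congˡ (dot-zeroʳ (coords t) tail≈0)) (+-identityʳ _)
    root-unique : ∀ x y → c₀ + enum x * head p ≈ 0# → c₀ + enum y * head p ≈ 0# → x ≡ y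
    root-unique x y x-root y-root = enum-injective x y
      (*-cancelˡ (head p) (nonZero∧tail≈0⇒head≉0 p p≢0 tail≈0)
        (trans (*-comm _ _) (trans (+-cancelˡ c₀ _ _ (trans x-root (sym y-root))) (*-comm _ _))))

  hyperplane-count : ∀ k (p : Vect (suc k)) → NonZero p →
    ∑ (finitePG k) (λ a → 𝟙 (dot (vec a) p ≟ 0#)) ≤ size (finiteBelow k)
  hyperplane-count zero p (zero , p₀≉0) =
    ℕₚ.≤-reflexive (≡.cong (ℕ._+ 0) (𝟙-no _ λ 1p₀+0≈0 →
      p₀≉0 (trans (sym (trans (+-identityʳ _) (*-identityˡ _))) 1p₀+0≈0)))
  hyperplane-count (suc k) p p≢0 with nonZero? (tail p)
  ... | yes tail≢0 = ℕₚ.+-mono-≤ (affine-count k (1# * head p) (tail p) tail≢0) (begin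
    ∑ (finitePG k) (λ a → 𝟙 (dot (vec (inj₂ a)) p ≟ 0#))
      ≡⟨ ∑-cong (finitePG k) (λ a → 𝟙-cong (dot (vec (inj₂ a)) p ≟ 0#) (dot (vec a) (tail p) ≟ 0#)
                                       (trans (sym (dot-0∷ˡ (vec a) p))) (trans (dot-0∷ˡ (vec a) p))) ⟩
    ∑ (finitePG k) (λ a → 𝟙 (dot (vec a) (tail p) ≟ 0#))
      ≤⟨ hyperplane-count k (tail p) tail≢0 ⟩
    size (finiteBelow k)
      ∎)
    where open ℕₚ.≤-Reasoning
  ... | no ¬tail≢0 =
    ℕₚ.+-mono-≤ {y = 0} affine-part (∑-mono-≤ (finitePG k) (λ a → 𝟙≤1 (dot (vec (inj₂ a)) p ≟ 0#)))
    where
    tail≈0 : tail p ≈ᵥ zeroᵥ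
    tail≈0 = ¬nonZero⇒≈0 (tail p) ¬tail≢0
    affine-part : ∑ (finiteCoords (suc k)) (λ x → 𝟙 (dot (vec (inj₁ x)) p ≟ 0#)) ≤ 0
    affine-part = ℕₚ.≤-trans (∑-mono-≤ (finiteCoords (suc k)) (λ x → ℕₚ.≤-reflexive (𝟙-no _ (off x))))
                             (ℕₚ.≤-reflexive (∑-zero (finiteCoords (suc k))))
      where
      off : ∀ x → ¬ 1# * head p + dot (coords x) (tail p) ≈ 0#
      off x on = nonZero∧tail≈0⇒head≉0 p p≢0 tail≈0
        (trans (sym (trans (+-cong (*-identityˡ _) (dot-zeroʳ (coords x) tail≈0)) (+-identityʳ _))) on)

  ∝-count : ∀ {k} (u : Vect (suc k)) → ∑ (finitePG k) (λ a → 𝟙 (u ∝? a)) ≤ 1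
  ∝-count {k} u = ∑-𝟙-≤1 (finitePG k) (u ∝?_) (λ _ _ → ∝-functional)

  ∃-avoiding : ∀ {k m n} (x : Fin m → Vect (suc (suc k))) → (∀ i → NonZero (x i)) →
               (y : Fin n → Vect (suc (suc k))) → m < q → n ≤ size (finitePG k) →
               ∃ λ (a : PG (suc k)) → (∀ i → ¬ dot (vec a) (x i) ≈ 0#) × (∀ j → ¬ y j ∝ a)
  ∃-avoiding {k} {m} {n} x x≢0 y m<q n≤S =
    let a , a-free = ∑<size⇒∃≡0 (finitePG (suc k)) {incidences} few-incidences in
    a , (λ i → 𝟙-zero⇒¬ _ (sum≡0⇒≡0 m (ℕₚ.m+n≡0⇒m≡0 _ a-free) i))
      , (λ j → 𝟙-zero⇒¬ _ (sum≡0⇒≡0 n (ℕₚ.m+n≡0⇒n≡0 _ a-free) j))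
    where
    open ℕₚ.≤-Reasoning
    S : ℕ
    S = size (finitePG k)
    P : Finite (PG (suc k))
    P = finitePG (suc k)
    on-hyperplane : PG (suc k) → Fin m → ℕ
    on-hyperplane a i = 𝟙 (dot (vec a) (x i) ≟ 0#)
    is-point : PG (suc k) → Fin n → ℕ
    is-point a j = 𝟙 (y j ∝? a)
    incidences : PG (suc k) → ℕ
    incidences a = ∑ (finiteFin m) (on-hyperplane a) ℕ.+ ∑ (finiteFin n) (is-point a)
    few-incidences : ∑ P incidences < size P
    few-incidences = begin-strict
      ∑ P incidences
        ≡⟨ ∑-distrib-+ P (λ a → ∑ (finiteFin m) (on-hyperplane a)) (λ a → ∑ (finiteFin n) (is-point a)) ⟩
      ∑ P (λ a → ∑ (finiteFin m) (on-hyperplane a)) ℕ.+ ∑ P (λ a → ∑ (finiteFin n) (is-point a))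
        ≡⟨ ≡.cong₂ ℕ._+_ (∑-comm-sum P m on-hyperplane) (∑-comm-sum P n is-point) ⟩
      ∑ (finiteFin m) (λ i → ∑ P (λ a → on-hyperplane a i)) ℕ.+ ∑ (finiteFin n) (λ j → ∑ P (λ a → is-point a j))
        ≤⟨ ℕₚ.+-mono-≤ (∑-≤-const (finiteFin m) S (λ i → hyperplane-count (suc k) (x i) (x≢0 i)))
                       (∑-≤-const (finiteFin n) 1 (λ j → ∝-count (y j))) ⟩
      size (finiteFin m) ℕ.* S ℕ.+ size (finiteFin n) ℕ.* 1
        ≡⟨ ≡.cong₂ (λ m′ n′ → m′ ℕ.* S ℕ.+ n′ ℕ.* 1) (size-finiteFin m) (size-finiteFin n) ⟩
      m ℕ.* S ℕ.+ n ℕ.* 1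
        ≤⟨ ℕₚ.+-monoʳ-≤ (m ℕ.* S) (ℕₚ.≤-trans (ℕₚ.≤-reflexive (ℕₚ.*-identityʳ n)) n≤S) ⟩
      m ℕ.* S ℕ.+ S
        ≡⟨ ℕₚ.+-comm (m ℕ.* S) S ⟩
      suc m ℕ.* S
        ≤⟨ ℕₚ.*-monoˡ-≤ S m<q ⟩
      q ℕ.* S
        <⟨ ℕₚ.m<m+n (q ℕ.* S) (s≤s z≤n) ⟩
      q ℕ.* S ℕ.+ 1
        ≡⟨ size-PG-suc k ⟨
      size P
        ∎

  -- Covers of PG(3,q)

  module _ {r s} (cover : Cover 4 r s) where
    open Cover cover

    pointVec : Fin r → Vect 4
    pointVec i = basis (points i) zero

    pointVec-nonZero : ∀ i → NonZero (pointVec i)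
    pointVec-nonZero i = independent⇒nonZero {bs = basis (points i)} (independent (points i)) zero

    planeNormal-spec : ∀ j → ∃ λ (f : Vect 4) → NonZero f × ∀ t → dot f (basis (planes j) t) ≈ 0#
    planeNormal-spec j = ∃-orthogonal (ℕₚ.n<1+n 3) (basis (planes j))

    planeNormal : Fin s → Vect 4
    planeNormal j = proj₁ (planeNormal-spec j)

    planeNormal-nonZero : ∀ j → NonZero (planeNormal j)
    planeNormal-nonZero j = proj₁ (proj₂ (planeNormal-spec j))

    planeNormal-⊥ : ∀ j {x} → x ∈Span basis (planes j) → dot (planeNormal j) x ≈ 0#
    planeNormal-⊥ j {x} x∈ =
      ∈Span-⊥ (planeNormal j) x (basis (planes j)) x∈ (proj₂ (proj₂ (planeNormal-spec j)))

    -- The lines of the plane (vec a)^⊥ are the images of the lines m^⊥ of PG(2,q).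
    lineIn : PG 3 → PG 2 → Line 4
    lineIn a m = subspace (λ t → lincomb (hyperplaneBasis m t) (hyperplaneBasis a))
                          (independent-lincomb {M = hyperplaneBasis m} {bs = hyperplaneBasis a}
                             (hyperplaneBasis-independent m) (hyperplaneBasis-independent a))

    plane-without-points⇒many-planes : ∀ a → (∀ i → ¬ dot (vec a) (pointVec i) ≈ 0#) →
      (∀ j → ¬ planeNormal j ∝ a) → size (finitePG 2) ≤ s
    plane-without-points⇒many-planes a a⊥̸points a≠planes =
      injective⇒size≤ (finitePG 2) coveringPlane coveringPlane-injective
      where
      L : PG 2 → Line 4
      L = lineIn a
      L⊆a⊥ : ∀ m t → dot (vec a) (basis (L m) t) ≈ 0#
      L⊆a⊥ m t = trans (dot-lincomb (vec a) (hyperplaneBasis m t) (hyperplaneBasis a))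
                       (dot-zeroʳ (hyperplaneBasis m t) (vec-⊥-hyperplaneBasis a))
      coveredByPlane : ∀ m → ∃ λ j → L m ⊆ₛ planes j
      coveredByPlane m with covers (L m)
      ... | inj₁ (i , pᵢ∈L) =
        ⊥-elim (a⊥̸points i (∈Span-⊥ (vec a) (pointVec i) (basis (L m)) (pᵢ∈L zero) (L⊆a⊥ m)))
      ... | inj₂ covered     = covered
      coveringPlane : PG 2 → Fin s
      coveringPlane m = proj₁ (coveredByPlane m)
      -- the line in which plane j meets (vec a)^⊥, in the coordinates given by hyperplaneBasis a
      trace : Fin s → Vect 3
      trace j i = dot (planeNormal j) (hyperplaneBasis a i)
      trace≢0 : ∀ j → NonZero (trace j)
      trace≢0 j with nonZero? (trace j)
      ... | yes ≢0  = ≢0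
      ... | no ¬≢0 =
        ⊥-elim (a≠planes j (⊥-hyperplaneBasis⇒∝ a (planeNormal-nonZero j) (¬nonZero⇒≈0 (trace j) ¬≢0)))
      trace-∝ : ∀ j m → L m ⊆ₛ planes j → trace j ∝ m
      trace-∝ j m L⊆j = ⊥-hyperplaneBasis⇒∝ m (trace≢0 j) trace⊥
        where
        trace⊥ : ∀ t → dot (trace j) (hyperplaneBasis m t) ≈ 0#
        trace⊥ t = trans (dot-comm (trace j) (hyperplaneBasis m t))
                         (trans (sym (dot-lincomb (planeNormal j) (hyperplaneBasis m t) (hyperplaneBasis a)))
                                (planeNormal-⊥ j (L⊆j t)))
      coveringPlane-injective : Injective _≡_ _≡_ coveringPlane
      coveringPlane-injective {m} {m′} same =
        ∝-functional (trace-∝ _ m (proj₂ (coveredByPlane m)))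
          (≡.subst (λ j → trace j ∝ m′) (≡.sym same) (trace-∝ _ m′ (proj₂ (coveredByPlane m′))))

    lineThroughBasis : PG 3 → PG 2 → Fin 2 → Vect 4
    lineThroughBasis a m = vec a ∷ complement a (vec m) ∷ []

    lineThroughBasis-lincomb : ∀ a m cs →
      lincomb cs (lineThroughBasis a m) ≈ᵥ ((cs zero ·ᵥ vec a) +ᵥ complement a (cs (suc zero) ·ᵥ vec m))
    lineThroughBasis-lincomb a m cs k =
      +-congˡ (trans (+-identityʳ _) (sym (complement-* a (cs (suc zero)) (vec m) k)))

    lineThrough : PG 3 → PG 2 → Line 4
    lineThrough a m = subspace (lineThroughBasis a m) independence
      where
      independence : Independent (lineThroughBasis a m)
      independence cs lin≈0 = coefficient
        where
        split : cs zero ≈ 0# × (cs (suc zero) ·ᵥ vec m) ≈ᵥ zeroᵥ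
        split = complement-unique a λ k →
          trans (sym (lineThroughBasis-lincomb a m cs k))
                (trans (lin≈0 k) (sym (trans (+-cong (zeroˡ _) (complement-zero a k)) (+-identityʳ 0#))))
        coefficient : ∀ i → cs i ≈ 0#
        coefficient zero       = proj₁ split
        coefficient (suc zero) = ·vec≈0⇒≈0 m (proj₂ split)

    point-off-planes⇒many-points : ∀ a → (∀ j → ¬ dot (vec a) (planeNormal j) ≈ 0#) →
      (∀ i → ¬ pointVec i ∝ a) → size (finitePG 2) ≤ r
    point-off-planes⇒many-points a a∉planes a≠points =
      injective⇒size≤ (finitePG 2) coveringPoint coveringPoint-injective
      where
      L : PG 2 → Line 4
      L = lineThrough a
      coveredByPoint : ∀ m → ∃ λ i → points i ⊆ₛ L m
      coveredByPoint m with covers (L m)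
      ... | inj₁ covered   = covered
      ... | inj₂ (j , L⊆j) =
        ⊥-elim (a∉planes j (trans (dot-comm (vec a) (planeNormal j)) (planeNormal-⊥ j (L⊆j zero))))
      coveringPoint : PG 2 → Fin r
      coveringPoint m = proj₁ (coveredByPoint m)
      Position : Fin r → PG 2 → Set (c ⊔ ℓ)
      Position i m = ∃ λ α → ∃ λ β → ¬ β ≈ 0# × pointVec i ≈ᵥ ((α ·ᵥ vec a) +ᵥ complement a (β ·ᵥ vec m))
      position : ∀ i m → points i ⊆ₛ L m → Position i m
      position i m pᵢ∈L with pᵢ∈L zero
      ... | cs , pᵢ≈ with cs (suc zero) ≟ 0#
      ...   | no β≉0  = cs zero , cs (suc zero) , β≉0 , λ k → trans (pᵢ≈ k) (lineThroughBasis-lincomb a m cs k)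
      ...   | yes β≈0 = ⊥-elim (a≠points i (multiple⇒∝ {a = a} (pointVec-nonZero i) pᵢ≈α·a))
        where
        pᵢ≈α·a : pointVec i ≈ᵥ (cs zero ·ᵥ vec a)
        pᵢ≈α·a k = trans (pᵢ≈ k) (trans (lineThroughBasis-lincomb a m cs k) (trans (+-congˡ
          (trans (complement-* a _ (vec m) k) (trans (*-congʳ β≈0) (zeroˡ _)))) (+-identityʳ _)))
      position-injective : ∀ i m m′ → Position i m → Position i m′ → m ≡ m′
      position-injective i m m′ (α , β , β≉0 , pᵢ≈) (α′ , β′ , β′≉0 , pᵢ≈′) =
        ·vec-injective m m′ β≉0 β′≉0 (proj₂ (complement-unique a (λ k → trans (sym (pᵢ≈ k)) (pᵢ≈′ k))))
      coveringPoint-injective : Injective _≡_ _≡_ coveringPoint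
      coveringPoint-injective {m} {m′} same =
        position-injective _ m m′ (position _ m (proj₂ (coveredByPoint m)))
          (≡.subst (λ i → Position i m′) (≡.sym same) (position _ m′ (proj₂ (coveredByPoint m′))))

open import Data.Nat using (_+_; _*_)

mainTheorem6 : ∀ {c ℓ : Level} (F : CommutativeRing c ℓ) → IsFieldRing F →
    (q : ℕ) → HasOrder F q →
    (r s : ℕ) → Linear.Cover F 4 r s →
    r + s ≤ q * q + q →
    (q ≤ r) × (q ≤ s)
mainTheorem6 F isField q order r s cover r+s≤q²+q = q≤r , q≤s
  where
  open ProjectiveSpace F isField q order
  r+s<|PG2| : r + s < size (finitePG 2)
  r+s<|PG2| = ≡.subst (r + s <_) (≡.sym size-PG2) (s≤s r+s≤q²+q)
  r<|PG2| : r < size (finitePG 2)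
  r<|PG2| = ℕₚ.≤-<-trans (ℕₚ.m≤m+n r s) r+s<|PG2|
  s<|PG2| : s < size (finitePG 2)
  s<|PG2| = ℕₚ.≤-<-trans (ℕₚ.m≤n+m s r) r+s<|PG2|
  q≤r : q ≤ r
  q≤r = ℕₚ.≮⇒≥ λ r<q →
    let a , a⊥̸points , a≠planes = ∃-avoiding (pointVec cover) (pointVec-nonZero cover) (planeNormal cover)
                                              r<q (ℕₚ.<⇒≤ s<|PG2|)
    in ℕₚ.<⇒≱ s<|PG2| (plane-without-points⇒many-planes cover a a⊥̸points a≠planes)
  q≤s : q ≤ s
  q≤s = ℕₚ.≮⇒≥ λ s<q →
    let a , a∉planes , a≠points = ∃-avoiding (planeNormal cover) (planeNormal-nonZero cover) (pointVec cover)
                                              s<q (ℕₚ.<⇒≤ r<|PG2|)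
    in ℕₚ.<⇒≱ r<|PG2| (point-off-planes⇒many-points cover a a∉planes a≠points)
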